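{- For every $n\in\mathbb{N}$, the number $\pi(n)$ of primes less than or equal to $n$ satisfies \[ \pi(n) \;=\; \nu_2\!\left( \frac{\operatorname{HW}(M(4\cdot n!))}{4\cdot n!+5} - (4\cdot n!+1)^2 \right) - 1 , \] where $M$ is the function defined in the context.
   Context: $\nu_2(m)$ denotes the exponent of $2$ in the prime factorization of the positive integer $m$, and $\operatorname{HW}(m)$ denotes the Hamming weight of $m\in\mathbb{N}$ (the number of $1$'s in its binary representation); $0!=1$. For integers $q>1$, $t\ge 0$, $r\ge 0$ put $G_r(q,t)=\sum_{j=0}^{t-1} j^r q^j$. For $m\in\mathbb{N}$ set $t=m+1$, $u=m+5$, $q_1=2^{2u}$, $q_2=2^{2ut}$ and define \[ M(m)=\frac{2^{u}\,(2^{2ut^2}-1)}{2^u+1}-(2^u-1)\Big[G_4(q_1,t)G_0(q_2,t)-2G_2(q_1,t)G_0(q_2,t)-2m\,G_2(q_1,t)G_1(q_2,t)+m^2G_0(q_1,t)G_2(q_2,t)+2m\,G_0(q_1,t)G_1(q_2,t)\Big]. \] -}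

module Defs where

open import Data.Nat using (ℕ; zero; suc; _+_; _*_; _∸_; _^_; _<_)
open import Data.Nat.DivMod using (_/_; _%_)
open import Data.Nat.Divisibility using (_∣_)
open import Data.Nat.Primality using (prime?)
open import Data.List using (List; upTo; filter; length; map)
open import Data.Nat.ListAction using (sum)
open import Data.Integer as ℤ using (ℤ; +_)
open import Data.Product using (_×_)
open import Relation.Nullary using (¬_)

-- Hamming weight: number of 1's in the binary expansion.
-- hwAux f n uses fuel f; f = n suffices since n / 2 < n for n > 0.
hwAux : ℕ → ℕ → ℕ
hwAux zero    n = 0
hwAux (suc f) zero = 0
hwAux (suc f) n@(suc _) = n % 2 + hwAux f (n / 2)

HW : ℕ → ℕ
HW n = hwAux n n

-- 2-adic valuation as a relation: ν₂(d) = k  (meaningful for d > 0)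
IsNu2 : ℕ → ℕ → Set
IsNu2 d k = (2 ^ k ∣ d) × ¬ (2 ^ suc k ∣ d)

primeCount : ℕ → ℕ
primeCount n = length (filter prime? (upTo (suc n)))

G : ℕ → ℕ → ℕ → ℕ
G r q t = sum (map (λ j → j ^ r * q ^ j) (upTo t))

-- M(m), an integer.  The first term 2^u(2^{2ut²}-1)/(2^u+1) is an exact
-- division (2^u+1 divides (2^u)^{2t²}-1); computed with ℕ division.
M : ℕ → ℤ
M m = + firstTerm ℤ.- (+ (2 ^ u ∸ 1)) ℤ.* bracket
  where
  t = suc m
  u = m + 5
  q₁ = 2 ^ (2 * u)
  q₂ = 2 ^ (2 * u * t)
  firstTerm : ℕ
  firstTerm = (2 ^ u * (2 ^ (2 * u * (t * t)) ∸ 1)) / (1 + 2 ^ u)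
  g : ℕ → ℕ → ℤ
  g r q = + G r q t
  bracket : ℤ
  bracket = g 4 q₁ ℤ.* g 0 q₂
            ℤ.- + 2 ℤ.* g 2 q₁ ℤ.* g 0 q₂
            ℤ.- + (2 * m) ℤ.* g 2 q₁ ℤ.* g 1 q₂
            ℤ.+ + (m * m) ℤ.* g 0 q₁ ℤ.* g 2 q₂
            ℤ.+ + (2 * m) ℤ.* g 0 q₁ ℤ.* g 1 q₂

{-# OPTIONS --safe #-}
-- Put t = m + 1, x = 2^u, X = x² and Y = X^t. Expanding the G's, the bracket of M(m) is
-- Σ_{i,j ≤ m} X^i Y^j ((i² − mj − 1)² − 1) and the first term is (x − 1) x Σ_{i,j ≤ m} X^i Y^j,
-- so M(m) is the number whose base-X digit at position i + t j is (x − 1)(x + 1 − Δ²), with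
-- Δ = i² − (mj + 1); the bound (m² + 1)² ≤ 2^u keeps every digit below X. Such a digit has
-- Hamming weight u, or 2u exactly when Δ = 0, so HW(M(m)) = u (t² + #{(i, j) : i² = mj + 1}).
-- For m = 4N only odd i = 2y + 1 occur, with j = y(y + 1)/N, so the count is twice the number
-- of roots of y(y + 1) modulo N. That number doubles when N is multiplied by a new prime and is
-- unchanged by a repeated one, hence equals 2^π(n) for N = n!.
module Submission where

open import Defs
open import Function using (_∘_)
open import Data.Nat using (ℕ; zero; suc; _+_; _*_; _∸_; _^_; _<_; _≤_; _!; s≤s; z<s; s<s; NonZero; ∣_-_∣; _≟_)
open import Data.Nat.Properties
open import Data.Nat.Tactic.RingSolver using (solve-∀)
open import Data.Nat.DivMod using (_/_; _%_; m/n<m; m%n<n; m≡m%n+[m/n]*n; m*n%n≡0; m*n/n≡m; [m+kn]%n≡m%n; +-distrib-/-∣ʳ)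
open import Data.Nat.Divisibility using (_∣_; _∤_; _∣?_; divides; ∣-refl; n∣m*n; ∣m+n∣m⇒∣n; ∣m∣n⇒∣m+n; ∣-trans; *-monoˡ-∣; *-cancelʳ-∣; m∣m*n; m≤n⇒m!∣n!; ∣m⇒∣m*n; ∣n⇒∣m*n; ∣⇒≤; ∣1⇒≡1)
open import Data.Nat.Primality using (Prime; prime?; euclidsLemma; prime⇒irreducible; prime⇒nonZero; productOfPrimes≢0; ¬prime[1])
open import Data.Nat.Coprimality using (Coprime; coprime-Bézout; coprime-divisor)
open import Data.Nat.GCD using (module Bézout)
import Data.Integer as ℤ
import Data.Integer.Properties as ℤₚ
import Data.Integer.Tactic.RingSolver as ℤ-Solver
open import Data.List using ([]; _∷_; applyUpTo; map; filter; length)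
open import Data.List.Relation.Unary.All as All using (All; []; _∷_)
open import Data.List.Membership.Propositional using (_∈_)
open import Data.Nat.Primality.Factorisation using (factorise; PrimeFactorisation)
open PrimeFactorisation using (factors; isFactorisation; factorsPrime)
open import Data.Nat.ListAction using (sum; product)
open import Data.Nat.ListAction.Properties using (∈⇒∣product)
open import Data.Product using (Σ; _×_; _,_; ∃-syntax)
open import Data.Sum using (_⊎_; inj₁; inj₂; [_,_]′; reduce)
open import Relation.Nullary using (¬_; Dec; yes; no; contradiction)
open import Level using (0ℓ)
open import Relation.Unary using (Pred; Decidable)
open import Relation.Binary.Definitions using (tri<; tri≈; tri>)
open import Relation.Binary.PropositionalEquality using (_≡_; _≢_; refl; sym; trans; cong; cong₂; subst; module ≡-Reasoning)

-- Finite sums and counting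

∑< : ℕ → (ℕ → ℕ) → ℕ
∑< zero    f = 0
∑< (suc n) f = f 0 + ∑< n (f ∘ suc)

infix 5 ∑<
syntax ∑< n (λ i → e) = ∑[ i < n ] e

∑-cong : ∀ n {f g : ℕ → ℕ} → (∀ i → i < n → f i ≡ g i) → ∑< n f ≡ ∑< n g
∑-cong zero    f≗g = refl
∑-cong (suc n) f≗g = cong₂ _+_ (f≗g 0 z<s) (∑-cong n (λ i i<n → f≗g (suc i) (s<s i<n)))

∑-distrib-+ : ∀ n (f g : ℕ → ℕ) → ∑[ i < n ] (f i + g i) ≡ ∑< n f + ∑< n g
∑-distrib-+ zero    f g = refl
∑-distrib-+ (suc n) f g = trans (cong ((f 0 + g 0) +_) (∑-distrib-+ n (f ∘ suc) (g ∘ suc)))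
                                (+-+-comm (f 0) (g 0) _ _)
  where
  +-+-comm : ∀ a b c d → (a + b) + (c + d) ≡ (a + c) + (b + d)
  +-+-comm = solve-∀

∑-const : ∀ n a → ∑[ i < n ] a ≡ n * a
∑-const zero    a = refl
∑-const (suc n) a = cong (a +_) (∑-const n a)

*-distribˡ-∑ : ∀ n a (f : ℕ → ℕ) → a * ∑< n f ≡ ∑[ i < n ] a * f i
*-distribˡ-∑ zero    a f = *-zeroʳ a
*-distribˡ-∑ (suc n) a f = trans (*-distribˡ-+ a (f 0) _) (cong (a * f 0 +_) (*-distribˡ-∑ n a (f ∘ suc)))

∑-split : ∀ m n (f : ℕ → ℕ) → ∑< (m + n) f ≡ ∑< m f + (∑[ k < n ] f (m + k))
∑-split zero    n f = refl
∑-split (suc m) n f = trans (cong (f 0 +_) (∑-split m n (f ∘ suc))) (sym (+-assoc (f 0) _ _))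

∑-blocks : ∀ k n (f : ℕ → ℕ) → ∑< (k * n) f ≡ ∑[ q < k ] ∑[ r < n ] f (q * n + r)
∑-blocks zero    n f = refl
∑-blocks (suc k) n f = trans (∑-split n (k * n) f) (cong (∑< n f +_) (trans (∑-blocks k n (λ i → f (n + i)))
  (∑-cong k (λ q _ → ∑-cong n (λ r _ → cong f (sym (+-assoc n (q * n) r)))))))

∑-swap : ∀ m n (f : ℕ → ℕ → ℕ) → ∑[ i < m ] ∑[ j < n ] f i j ≡ ∑[ j < n ] ∑[ i < m ] f i j
∑-swap zero    n f = sym (trans (∑-const n 0) (*-zeroʳ n))
∑-swap (suc m) n f = trans (cong (∑< n (f 0) +_) (∑-swap m n (f ∘ suc)))
                           (sym (∑-distrib-+ n (f 0) (λ j → ∑[ i < m ] f (suc i) j)))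

∑-*-∑ : ∀ m n (f g : ℕ → ℕ) → ∑< m f * ∑< n g ≡ ∑[ j < n ] ∑[ i < m ] f i * g j
∑-*-∑ m n f g = trans (*-distribˡ-∑ n (∑< m f) g) (∑-cong n (λ j _ →
  trans (*-comm (∑< m f) (g j)) (trans (*-distribˡ-∑ m (g j) f) (∑-cong m (λ i _ → *-comm (g j) (f i))))))

∑² : ℕ → (ℕ → ℕ → ℕ) → ℕ
∑² n f = ∑[ j < n ] ∑[ i < n ] f i j

∑²-cong : ∀ n {f g : ℕ → ℕ → ℕ} → (∀ i j → i < n → j < n → f i j ≡ g i j) → ∑² n f ≡ ∑² n g
∑²-cong n f≗g = ∑-cong n (λ j j<n → ∑-cong n (λ i i<n → f≗g i j i<n j<n))

∑²-+ : ∀ n (f g : ℕ → ℕ → ℕ) → ∑² n f + ∑² n g ≡ ∑² n (λ i j → f i j + g i j)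
∑²-+ n f g = sym (trans (∑-cong n (λ j _ → ∑-distrib-+ n (λ i → f i j) (λ i → g i j)))
                        (∑-distrib-+ n (λ j → ∑[ i < n ] f i j) (λ j → ∑[ i < n ] g i j)))

*-distribˡ-∑² : ∀ n c (f : ℕ → ℕ → ℕ) → c * ∑² n f ≡ ∑² n (λ i j → c * f i j)
*-distribˡ-∑² n c f = trans (*-distribˡ-∑ n c (λ j → ∑[ i < n ] f i j)) (∑-cong n (λ j _ → *-distribˡ-∑ n c (λ i → f i j)))

∑²-linear : ∀ n c (f g h : ℕ → ℕ → ℕ) → ∑² n f + c * (∑² n g + ∑² n h) ≡ ∑² n (λ i j → f i j + c * (g i j + h i j))
∑²-linear n c f g h = begin
  ∑² n f + c * (∑² n g + ∑² n h)                 ≡⟨ cong (λ z → ∑² n f + c * z) (∑²-+ n g h) ⟩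
  ∑² n f + c * ∑² n (λ i j → g i j + h i j)      ≡⟨ cong (∑² n f +_) (*-distribˡ-∑² n c (λ i j → g i j + h i j)) ⟩
  ∑² n f + ∑² n (λ i j → c * (g i j + h i j))    ≡⟨ ∑²-+ n f (λ i j → c * (g i j + h i j)) ⟩
  ∑² n (λ i j → f i j + c * (g i j + h i j))     ∎
  where open ≡-Reasoning

∑²[1+f]≡n*n+∑²f : ∀ n (f : ℕ → ℕ → ℕ) → ∑² n (λ i j → 1 + f i j) ≡ n * n + ∑² n f
∑²[1+f]≡n*n+∑²f n f = begin
  ∑[ j < n ] ∑[ i < n ] (1 + f i j)                   ≡⟨ ∑-cong n (λ j _ → ∑-distrib-+ n (λ _ → 1) (λ i → f i j)) ⟩
  ∑[ j < n ] ((∑[ i < n ] 1) + (∑[ i < n ] f i j))     ≡⟨ ∑-distrib-+ n (λ _ → ∑[ i < n ] 1) (λ j → ∑[ i < n ] f i j) ⟩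
  (∑[ j < n ] ∑[ i < n ] 1) + ∑² n f                  ≡⟨ cong (_+ ∑² n f) (trans (∑-const n (∑[ i < n ] 1)) (cong (n *_) (trans (∑-const n 1) (*-identityʳ n)))) ⟩
  n * n + ∑² n f                                      ∎
  where open ≡-Reasoning

sum-map-applyUpTo : ∀ n (f g : ℕ → ℕ) → sum (map f (applyUpTo g n)) ≡ ∑[ i < n ] f (g i)
sum-map-applyUpTo zero    f g = refl
sum-map-applyUpTo (suc n) f g = cong (f (g 0) +_) (sum-map-applyUpTo n f (g ∘ suc))

𝟙 : ∀ {A : Set} → Dec A → ℕ
𝟙 (yes _) = 1
𝟙 (no _)  = 0

𝟙-yes : ∀ {A : Set} (a? : Dec A) → A → 𝟙 a? ≡ 1
𝟙-yes (yes _) a = refl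
𝟙-yes (no ¬a) a = contradiction a ¬a

𝟙-no : ∀ {A : Set} (a? : Dec A) → ¬ A → 𝟙 a? ≡ 0
𝟙-no (yes a) ¬a = contradiction a ¬a
𝟙-no (no _)  ¬a = refl

𝟙-cong : ∀ {A B : Set} (a? : Dec A) (b? : Dec B) → (A → B) → (B → A) → 𝟙 a? ≡ 𝟙 b?
𝟙-cong (yes a) b? to from = sym (𝟙-yes b? (to a))
𝟙-cong (no ¬a) b? to from = sym (𝟙-no b? (¬a ∘ from))

𝟙-⊎ : ∀ {A B C : Set} (a? : Dec A) (b? : Dec B) (c? : Dec C) →
      (C → A ⊎ B) → (A → C) → (B → C) → (A → ¬ B) → 𝟙 c? ≡ 𝟙 a? + 𝟙 b?
𝟙-⊎ (yes a) (yes b) c? _ _ _ a⇒¬b = contradiction b (a⇒¬b a)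
𝟙-⊎ (yes a) (no _)  c? _ a⇒c _ _ = 𝟙-yes c? (a⇒c a)
𝟙-⊎ (no _)  (yes b) c? _ _ b⇒c _ = 𝟙-yes c? (b⇒c b)
𝟙-⊎ (no ¬a) (no ¬b) c? c⇒a⊎b _ _ _ = 𝟙-no c? λ c → [ ¬a , ¬b ]′ (c⇒a⊎b c)

count-none : ∀ n {P : Pred ℕ 0ℓ} (P? : Decidable P) → (∀ i → i < n → ¬ P i) → ∑[ i < n ] 𝟙 (P? i) ≡ 0
count-none n P? none = trans (∑-cong n (λ i i<n → 𝟙-no (P? i) (none i i<n))) (trans (∑-const n 0) (*-zeroʳ n))

count-unique : ∀ n {P : Pred ℕ 0ℓ} (P? : Decidable P) {k} → k < n → P k → (∀ i → i < n → P i → i ≡ k) →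
               ∑[ i < n ] 𝟙 (P? i) ≡ 1
count-unique (suc n) P? {zero} _ P0 unique =
  cong₂ _+_ (𝟙-yes (P? 0) P0) (count-none n (P? ∘ suc) (λ i i<n Pi → 1+n≢0 (unique (suc i) (s<s i<n) Pi)))
count-unique (suc n) P? {suc k} (s<s k<n) Pk unique =
  cong₂ _+_ (𝟙-no (P? 0) (λ P0 → 1+n≢0 (sym (unique 0 z<s P0))))
            (count-unique n (P? ∘ suc) k<n Pk (λ i i<n Pi → suc-injective (unique (suc i) (s<s i<n) Pi)))

-- Hamming weight

private
  half≤ : ∀ n → suc n / 2 ≤ n
  half≤ n = ≤-pred (m/n<m (suc n) 2 (s<s z<s))

hwAux-fuel : ∀ f g n → n ≤ f → n ≤ g → hwAux f n ≡ hwAux g n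
hwAux-fuel zero    zero    zero _ _ = refl
hwAux-fuel zero    (suc g) zero _ _ = refl
hwAux-fuel (suc f) zero    zero _ _ = refl
hwAux-fuel (suc f) (suc g) zero _ _ = refl
hwAux-fuel (suc f) (suc g) (suc n) (s≤s n≤f) (s≤s n≤g) =
  cong (suc n % 2 +_) (hwAux-fuel f g (suc n / 2) (≤-trans (half≤ n) n≤f) (≤-trans (half≤ n) n≤g))

HW-suc : ∀ n → HW (suc n) ≡ suc n % 2 + HW (suc n / 2)
HW-suc n = cong (suc n % 2 +_) (hwAux-fuel n (suc n / 2) (suc n / 2) (half≤ n) ≤-refl)

HW[2n]≡HW[n] : ∀ n → HW (2 * n) ≡ HW n
HW[2n]≡HW[n] zero        = refl
HW[2n]≡HW[n] n@(suc n-1) = begin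
  HW (2 * n)                    ≡⟨ HW-suc (n-1 + 1 * n) ⟩
  2 * n % 2 + HW (2 * n / 2)    ≡⟨ cong (λ k → k % 2 + HW (k / 2)) (*-comm 2 n) ⟩
  n * 2 % 2 + HW (n * 2 / 2)    ≡⟨ cong₂ _+_ (m*n%n≡0 n 2) (cong HW (m*n/n≡m n 2)) ⟩
  HW n                          ∎
  where open ≡-Reasoning

HW[1+2n]≡1+HW[n] : ∀ n → HW (1 + 2 * n) ≡ 1 + HW n
HW[1+2n]≡1+HW[n] n = begin
  HW (1 + 2 * n)                        ≡⟨ HW-suc (2 * n) ⟩
  (1 + 2 * n) % 2 + HW ((1 + 2 * n) / 2) ≡⟨ cong (λ k → (1 + k) % 2 + HW ((1 + k) / 2)) (*-comm 2 n) ⟩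
  (1 + n * 2) % 2 + HW ((1 + n * 2) / 2) ≡⟨ cong₂ _+_ ([m+kn]%n≡m%n 1 n 2) (cong HW (+-distrib-/-∣ʳ 1 (n∣m*n n {2}))) ⟩
  1 + HW (n * 2 / 2)                     ≡⟨ cong (λ k → 1 + HW k) (m*n/n≡m n 2) ⟩
  1 + HW n                               ∎
  where open ≡-Reasoning

parity : ∀ a → ∃[ h ] (a ≡ 2 * h ⊎ a ≡ 1 + 2 * h)
parity zero = 0 , inj₁ refl
parity (suc a) with parity a
... | h , inj₁ refl = h , inj₂ refl
... | h , inj₂ refl = suc h , inj₁ (sym (+-suc (suc h) (h + 0)))

private
  double-+ : ∀ h p b → 2 * (h + p * b) ≡ 2 * h + 2 * p * b
  double-+ = solve-∀

HW[a+2^L*b]≡HW[a]+HW[b] : ∀ L a b → a < 2 ^ L → HW (a + 2 ^ L * b) ≡ HW a + HW b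
HW[a+2^L*b]≡HW[a]+HW[b] zero    zero b _ = cong HW (+-identityʳ b)
HW[a+2^L*b]≡HW[a]+HW[b] zero    (suc a) b (s<s ())
HW[a+2^L*b]≡HW[a]+HW[b] (suc L) a b a<2^[1+L] with parity a
... | h , inj₁ refl = begin
  HW (2 * h + 2 * 2 ^ L * b)  ≡⟨ cong HW (double-+ h (2 ^ L) b) ⟨
  HW (2 * (h + 2 ^ L * b))    ≡⟨ HW[2n]≡HW[n] (h + 2 ^ L * b) ⟩
  HW (h + 2 ^ L * b)          ≡⟨ HW[a+2^L*b]≡HW[a]+HW[b] L h b (*-cancelˡ-< 2 h (2 ^ L) a<2^[1+L]) ⟩
  HW h + HW b                 ≡⟨ cong (_+ HW b) (HW[2n]≡HW[n] h) ⟨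
  HW (2 * h) + HW b           ∎
  where open ≡-Reasoning
... | h , inj₂ refl = begin
  HW (1 + 2 * h + 2 * 2 ^ L * b)  ≡⟨ cong (λ k → HW (1 + k)) (double-+ h (2 ^ L) b) ⟨
  HW (1 + 2 * (h + 2 ^ L * b))    ≡⟨ HW[1+2n]≡1+HW[n] (h + 2 ^ L * b) ⟩
  1 + HW (h + 2 ^ L * b)          ≡⟨ cong suc (HW[a+2^L*b]≡HW[a]+HW[b] L h b (*-cancelˡ-< 2 h (2 ^ L) (≤-trans (n≤1+n _) a<2^[1+L]))) ⟩
  1 + HW h + HW b                 ≡⟨ cong (_+ HW b) (HW[1+2n]≡1+HW[n] h) ⟨
  HW (1 + 2 * h) + HW b           ∎
  where open ≡-Reasoning

private
  even+even+1 : ∀ h k → 2 * h + 2 * k + 1 ≡ suc (2 * (h + k))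
  even+even+1 = solve-∀
  odd+odd+1 : ∀ h k → 1 + 2 * h + (1 + 2 * k) + 1 ≡ suc (2 * (h + k + 1))
  odd+odd+1 = solve-∀
  even+odd+1 : ∀ h k → 2 * (h + k + 1) ≡ 2 * h + (1 + 2 * k) + 1
  even+odd+1 = solve-∀
  odd+even+1 : ∀ h k → 2 * (h + k + 1) ≡ 1 + 2 * h + 2 * k + 1
  odd+even+1 = solve-∀
  halve : ∀ {m n} → 2 * m ≡ 2 * n → m ≡ n
  halve {m} {n} = *-cancelˡ-≡ m n 2

HW-complement : ∀ L a b → a + b + 1 ≡ 2 ^ L → HW a + HW b ≡ L
HW-complement zero    zero    zero    _  = refl
HW-complement zero    (suc a) b       eq = contradiction (m+n≡0⇒n≡0 (a + b) (suc-injective eq)) λ ()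
HW-complement zero    zero    (suc b) eq = contradiction (m+n≡0⇒n≡0 b (suc-injective eq)) λ ()
HW-complement (suc L) a       b       eq with parity a | parity b
... | h , inj₁ refl | k , inj₁ refl = contradiction (trans (sym eq) (even+even+1 h k)) (even≢odd (2 ^ L) (h + k))
... | h , inj₂ refl | k , inj₂ refl = contradiction (trans (sym eq) (odd+odd+1 h k)) (even≢odd (2 ^ L) (h + k + 1))
... | h , inj₁ refl | k , inj₂ refl = begin
  HW (2 * h) + HW (1 + 2 * k) ≡⟨ cong₂ _+_ (HW[2n]≡HW[n] h) (HW[1+2n]≡1+HW[n] k) ⟩
  HW h + (1 + HW k)           ≡⟨ +-suc (HW h) (HW k) ⟩
  1 + (HW h + HW k)           ≡⟨ cong suc (HW-complement L h k (halve (trans (even+odd+1 h k) eq))) ⟩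
  1 + L                       ∎
  where open ≡-Reasoning
... | h , inj₂ refl | k , inj₁ refl = begin
  HW (1 + 2 * h) + HW (2 * k) ≡⟨ cong₂ _+_ (HW[1+2n]≡1+HW[n] h) (HW[2n]≡HW[n] k) ⟩
  1 + (HW h + HW k)           ≡⟨ cong suc (HW-complement L h k (halve (trans (odd+even+1 h k) eq))) ⟩
  1 + L                       ∎
  where open ≡-Reasoning

digits-suc : ∀ b n (c : ℕ → ℕ) → ∑[ i < suc n ] b ^ i * c i ≡ c 0 + b * (∑[ i < n ] b ^ i * c (suc i))
digits-suc b n c = cong₂ _+_ (*-identityˡ (c 0)) (sym (trans (*-distribˡ-∑ n b (λ i → b ^ i * c (suc i)))
  (∑-cong n (λ i _ → sym (*-assoc b (b ^ i) (c (suc i)))))))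

digits-< : ∀ b n (c : ℕ → ℕ) → (∀ i → i < n → c i < b) → ∑[ i < n ] b ^ i * c i < b ^ n
digits-< b zero    c c<b = z<s
digits-< b (suc n) c c<b = begin-strict
  ∑[ i < suc n ] b ^ i * c i     ≡⟨ digits-suc b n c ⟩
  c 0 + b * rest                 <⟨ +-monoˡ-< (b * rest) (c<b 0 z<s) ⟩
  b + b * rest                   ≡⟨ *-suc b rest ⟨
  b * suc rest                   ≤⟨ *-monoʳ-≤ b (digits-< b n (c ∘ suc) (λ i i<n → c<b (suc i) (s<s i<n))) ⟩
  b * b ^ n                      ∎
  where
  open ≤-Reasoning
  rest : ℕ
  rest = ∑[ i < n ] b ^ i * c (suc i)

HW-digits : ∀ L n (c : ℕ → ℕ) → (∀ i → i < n → c i < 2 ^ L) →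
            HW (∑[ i < n ] (2 ^ L) ^ i * c i) ≡ ∑[ i < n ] HW (c i)
HW-digits L zero    c c<2^L = refl
HW-digits L (suc n) c c<2^L = begin
  HW (∑[ i < suc n ] (2 ^ L) ^ i * c i)                    ≡⟨ cong HW (digits-suc (2 ^ L) n c) ⟩
  HW (c 0 + 2 ^ L * (∑[ i < n ] (2 ^ L) ^ i * c (suc i)))  ≡⟨ HW[a+2^L*b]≡HW[a]+HW[b] L (c 0) _ (c<2^L 0 z<s) ⟩
  HW (c 0) + HW (∑[ i < n ] (2 ^ L) ^ i * c (suc i))       ≡⟨ cong (HW (c 0) +_) (HW-digits L n (c ∘ suc) (λ i i<n → c<2^L (suc i) (s<s i<n))) ⟩
  ∑[ i < suc n ] HW (c i)                                  ∎
  where open ≡-Reasoning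

-- For s = r + 1 the product is r + x (x − 1 − r), whose two digits are complementary u-bit
-- strings; for s = 0 it is (x − 1) + x (x − 1).
HW-block : ∀ u s → s ≤ 2 ^ u → HW ((2 ^ u ∸ 1) * (2 ^ u + 1 ∸ s)) ≡ u * (1 + 𝟙 (s ≟ 0))
HW-block u s s≤2^u with 2 ^ u in 2^u≡1+w | m^n>0 2 u
... | suc w | _ with s | s≤2^u
...   | zero  | _ = begin
  HW (w * (suc w + 1))   ≡⟨ cong HW (split w) ⟩
  HW (w + suc w * w)     ≡⟨ cong (λ x → HW (w + x * w)) 2^u≡1+w ⟨
  HW (w + 2 ^ u * w)     ≡⟨ HW[a+2^L*b]≡HW[a]+HW[b] u w w (≤-reflexive (sym 2^u≡1+w)) ⟩
  HW w + HW w            ≡⟨ cong₂ _+_ HW[w]≡u HW[w]≡u ⟩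
  u + u                  ≡⟨ double u ⟩
  u * (1 + 1)            ∎
  where
  open ≡-Reasoning
  split : ∀ w → w * (suc w + 1) ≡ w + suc w * w
  split = solve-∀
  double : ∀ u → u + u ≡ u * (1 + 1)
  double = solve-∀
  HW[w]≡u : HW w ≡ u
  HW[w]≡u = trans (sym (+-identityʳ (HW w)))
    (HW-complement u w 0 (trans (trans (cong (_+ 1) (+-identityʳ w)) (+-comm w 1)) (sym 2^u≡1+w)))
...   | suc r | s≤s r≤w with m≤n⇒∃[o]m+o≡n r≤w
...     | d , refl = begin
  HW ((r + d) * (suc (r + d) + 1 ∸ suc r))  ≡⟨ cong HW (split r d) ⟩
  HW (r + suc (r + d) * d)                  ≡⟨ cong (λ x → HW (r + x * d)) 2^u≡1+w ⟨
  HW (r + 2 ^ u * d)                        ≡⟨ HW[a+2^L*b]≡HW[a]+HW[b] u r d (subst (r <_) (sym 2^u≡1+w) (s≤s (m≤m+n r d))) ⟩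
  HW r + HW d                               ≡⟨ HW-complement u r d (trans (+-comm (r + d) 1) (sym 2^u≡1+w)) ⟩
  u                                         ≡⟨ *-identityʳ u ⟨
  u * (1 + 0)                               ∎
  where
  open ≡-Reasoning
  split : ∀ r d → (r + d) * (suc (r + d) + 1 ∸ suc r) ≡ r + suc (r + d) * d
  split r d = trans (cong ((r + d) *_) (trans (cong (_∸ r) (+-assoc r d 1)) (m+n∸m≡n r (d + 1)))) (expand r d)
    where
    expand : ∀ r d → (r + d) * (d + 1) ≡ r + suc (r + d) * d
    expand = solve-∀

block-< : ∀ x s → 0 < x → (x ∸ 1) * (x + 1 ∸ s) < x * x
block-< (suc w) s _ = begin-strict
  w * (suc w + 1 ∸ s)    ≤⟨ *-monoʳ-≤ w (m∸n≤m (suc w + 1) s) ⟩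
  w * (suc w + 1)        <⟨ n<1+n _ ⟩
  suc (w * (suc w + 1))  ≡⟨ square w ⟩
  suc w * suc w          ∎
  where
  open ≤-Reasoning
  square : ∀ w → suc (w * (suc w + 1)) ≡ suc w * suc w
  square = solve-∀

geometric : ∀ {b c} n → b ≡ suc c → b ^ n ≡ suc (c * (∑[ i < n ] b ^ i))
geometric {b} {c} zero    refl = cong suc (sym (*-zeroʳ c))
geometric {b} {c} (suc n) refl = begin
  b * b ^ n                                   ≡⟨ cong (b *_) (geometric n refl) ⟩
  b * suc (c * S)                             ≡⟨ step c S ⟩
  suc (c * (1 + b * S))                       ≡⟨ cong (λ z → suc (c * (1 + z))) (*-distribˡ-∑ n b (b ^_)) ⟩
  suc (c * (∑[ i < suc n ] b ^ i))            ∎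
  where
  open ≡-Reasoning
  S : ℕ
  S = ∑[ i < n ] b ^ i
  step : ∀ c S → suc c * suc (c * S) ≡ suc (c * (1 + suc c * S))
  step = solve-∀

private
  ∣m-n∣²+2mn≡m²+n²-≤ : ∀ {m n} → m ≤ n → ∣ m - n ∣ * ∣ m - n ∣ + 2 * (m * n) ≡ m * m + n * n
  ∣m-n∣²+2mn≡m²+n²-≤ {m} m≤n with m≤n⇒∃[o]m+o≡n m≤n
  ... | d , refl = trans (cong (λ z → z * z + 2 * (m * (m + d))) (∣m-m+n∣≡n m d)) (expand m d)
    where
    expand : ∀ m d → d * d + 2 * (m * (m + d)) ≡ m * m + (m + d) * (m + d)
    expand = solve-∀

∣m-n∣²+2mn≡m²+n² : ∀ m n → ∣ m - n ∣ * ∣ m - n ∣ + 2 * (m * n) ≡ m * m + n * n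
∣m-n∣²+2mn≡m²+n² m n with ≤-total m n
... | inj₁ m≤n = ∣m-n∣²+2mn≡m²+n²-≤ m≤n
... | inj₂ n≤m = begin
  ∣ m - n ∣ * ∣ m - n ∣ + 2 * (m * n)  ≡⟨ cong₂ (λ a b → a * a + 2 * b) (∣-∣-comm m n) (*-comm m n) ⟩
  ∣ n - m ∣ * ∣ n - m ∣ + 2 * (n * m)  ≡⟨ ∣m-n∣²+2mn≡m²+n²-≤ n≤m ⟩
  n * n + m * m                        ≡⟨ +-comm (n * n) (m * m) ⟩
  m * m + n * n                        ∎
  where open ≡-Reasoning

[m²+1]²≤2^[m+5] : ∀ m → (m * m + 1) * (m * m + 1) ≤ 2 ^ (m + 5)
[m²+1]²≤2^[m+5] 0 = ≤ᵇ⇒≤ _ _ _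
[m²+1]²≤2^[m+5] 1 = ≤ᵇ⇒≤ _ _ _
[m²+1]²≤2^[m+5] 2 = ≤ᵇ⇒≤ _ _ _
[m²+1]²≤2^[m+5] 3 = ≤ᵇ⇒≤ _ _ _
[m²+1]²≤2^[m+5] 4 = ≤ᵇ⇒≤ _ _ _
[m²+1]²≤2^[m+5] 5 = ≤ᵇ⇒≤ _ _ _
[m²+1]²≤2^[m+5] 6 = ≤ᵇ⇒≤ _ _ _
[m²+1]²≤2^[m+5] (suc m@(suc (suc (suc (suc (suc (suc a))))))) = begin
  f (suc m)                   ≤⟨ m≤m+n (f (suc m)) _ ⟩
  f (suc m) + slack           ≡⟨ step a ⟩
  2 * f m                     ≤⟨ *-monoʳ-≤ 2 ([m²+1]²≤2^[m+5] m) ⟩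
  2 * 2 ^ (m + 5)             ∎
  where
  open ≤-Reasoning
  f : ℕ → ℕ
  f m = (m * m + 1) * (m * m + 1)
  slack : ℕ
  slack = a * a * a * a + 20 * a * a * a + 140 * a * a + 376 * a + 238
  step : ∀ a → ((7 + a) * (7 + a) + 1) * ((7 + a) * (7 + a) + 1) + (a * a * a * a + 20 * a * a * a + 140 * a * a + 376 * a + 238)
             ≡ 2 * (((6 + a) * (6 + a) + 1) * ((6 + a) * (6 + a) + 1))
  step = solve-∀

-- M is the only integer-valued quantity: its expansion is proved in ℕ with the negative terms
-- moved to the other side, and transported back by this lemma.
module _ where
  open ℤ using (+_)

  +a-+w*[q₁-q₂-q₃+q₄+q₅]≡+k : ∀ a k w q₁ q₂ q₃ q₄ q₅ → a + w * (q₂ + q₃) ≡ k + w * (q₁ + q₄ + q₅) →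
                  + a ℤ.- + w ℤ.* (+ q₁ ℤ.- + q₂ ℤ.- + q₃ ℤ.+ + q₄ ℤ.+ + q₅) ≡ + k
  +a-+w*[q₁-q₂-q₃+q₄+q₅]≡+k a k w q₁ q₂ q₃ q₄ q₅ eq = begin
    + a ℤ.- + w ℤ.* (+ q₁ ℤ.- + q₂ ℤ.- + q₃ ℤ.+ + q₄ ℤ.+ + q₅)                       ≡⟨ regroup (+ a) (+ w) (+ q₁) (+ q₂) (+ q₃) (+ q₄) (+ q₅) ⟩
    (+ a ℤ.+ + w ℤ.* (+ q₂ ℤ.+ + q₃)) ℤ.- + w ℤ.* (+ q₁ ℤ.+ + q₄ ℤ.+ + q₅)         ≡⟨ cong₂ ℤ._-_ (cast-+* a w q₂ q₃) (cong (λ z → + w ℤ.* z) (cast-+ q₁ q₄ q₅)) ⟨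
    + (a + w * (q₂ + q₃)) ℤ.- + w ℤ.* + (q₁ + q₄ + q₅)                               ≡⟨ cong₂ ℤ._-_ (trans (cong +_ eq) (ℤₚ.pos-+ k _)) (sym (ℤₚ.pos-* w _)) ⟩
    (+ k ℤ.+ + (w * (q₁ + q₄ + q₅))) ℤ.- + (w * (q₁ + q₄ + q₅))                     ≡⟨ cancel (+ k) (+ (w * (q₁ + q₄ + q₅))) ⟩
    + k                                                                             ∎
    where
    open ≡-Reasoning
    cast-+* : ∀ a w b c → + (a + w * (b + c)) ≡ + a ℤ.+ + w ℤ.* (+ b ℤ.+ + c)
    cast-+* a w b c = trans (ℤₚ.pos-+ a _) (cong (λ z → + a ℤ.+ z) (trans (ℤₚ.pos-* w _) (cong (λ z → + w ℤ.* z) (ℤₚ.pos-+ b c))))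
    cast-+ : ∀ a b c → + (a + b + c) ≡ + a ℤ.+ + b ℤ.+ + c
    cast-+ a b c = trans (ℤₚ.pos-+ (a + b) c) (cong (λ z → z ℤ.+ + c) (ℤₚ.pos-+ a b))
    regroup : ∀ a w q₁ q₂ q₃ q₄ q₅ → a ℤ.- w ℤ.* (q₁ ℤ.- q₂ ℤ.- q₃ ℤ.+ q₄ ℤ.+ q₅)
                                     ≡ (a ℤ.+ w ℤ.* (q₂ ℤ.+ q₃)) ℤ.- w ℤ.* (q₁ ℤ.+ q₄ ℤ.+ q₅)
    regroup = ℤ-Solver.solve-∀
    cancel : ∀ k p → (k ℤ.+ p) ℤ.- p ≡ k
    cancel = ℤ-Solver.solve-∀

-- The base-X expansion of M

solutionsAt : ℕ → ℕ → ℕ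
solutionsAt m i = ∑[ j < suc m ] 𝟙 (i * i ≟ m * j + 1)

solutionCount : ℕ → ℕ
solutionCount m = ∑[ i < suc m ] solutionsAt m i

G≡∑ : ∀ r q n → G r q n ≡ ∑[ j < n ] j ^ r * q ^ j
G≡∑ r q n = sum-map-applyUpTo n (λ j → j ^ r * q ^ j) (λ j → j)

module BaseExpansion (m : ℕ) where
  t u x w X Y : ℕ
  t = suc m
  u = m + 5
  x = 2 ^ u
  w = x ∸ 1
  X = 2 ^ (2 * u)
  Y = 2 ^ (2 * u * t)

  Δ : ℕ → ℕ → ℕ
  Δ i j = ∣ i * i - (m * j + 1) ∣

  V : ℕ → ℕ → ℕ
  V i j = w * (x + 1 ∸ Δ i j * Δ i j)

  K : ℕ
  K = ∑[ j < t ] Y ^ j * (∑[ i < t ] X ^ i * V i j)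

  firstTerm : ℕ
  firstTerm = 2 ^ u * (2 ^ (2 * u * (t * t)) ∸ 1) / (1 + 2 ^ u)

  private
    x>0 : 0 < x
    x>0 = m^n>0 2 u

    X≡x*x : X ≡ x * x
    X≡x*x = trans (cong (2 ^_) (cong (u +_) (+-identityʳ u))) (^-distribˡ-+-* 2 u u)

    Δ≤m²+1 : ∀ {i j} → i ≤ m → j ≤ m → Δ i j ≤ m * m + 1
    Δ≤m²+1 {i} {j} i≤m j≤m = ≤-trans (∣m-n∣≤m⊔n (i * i) (m * j + 1))
      (⊔-lub (≤-trans (*-mono-≤ i≤m i≤m) (m≤m+n (m * m) 1)) (+-monoˡ-≤ 1 (*-monoʳ-≤ m j≤m)))

    Δ²≤x : ∀ {i j} → i < t → j < t → Δ i j * Δ i j ≤ x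
    Δ²≤x (s≤s i≤m) (s≤s j≤m) = ≤-trans (*-mono-≤ (Δ≤m²+1 i≤m j≤m) (Δ≤m²+1 i≤m j≤m)) ([m²+1]²≤2^[m+5] m)

    Δ²≡0⇒i²≡mj+1 : ∀ {i j} → Δ i j * Δ i j ≡ 0 → i * i ≡ m * j + 1
    Δ²≡0⇒i²≡mj+1 {i} {j} Δ²≡0 = ∣m-n∣≡0⇒m≡n (reduce (m*n≡0⇒m≡0∨n≡0 (Δ i j) Δ²≡0))

    i²≡mj+1⇒Δ²≡0 : ∀ {i j} → i * i ≡ m * j + 1 → Δ i j * Δ i j ≡ 0
    i²≡mj+1⇒Δ²≡0 {i} {j} eq = cong (λ d → d * d) (m≡n⇒∣m-n∣≡0 eq)

    HW-V : ∀ {i j} → i < t → j < t → HW (V i j) ≡ u * (1 + 𝟙 (i * i ≟ m * j + 1))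
    HW-V {i} {j} i<t j<t = trans (HW-block u (Δ i j * Δ i j) (Δ²≤x i<t j<t))
      (cong (λ c → u * (1 + c)) (𝟙-cong (Δ i j * Δ i j ≟ 0) (i * i ≟ m * j + 1) (Δ²≡0⇒i²≡mj+1 {i}) (i²≡mj+1⇒Δ²≡0 {i})))

    V<X : ∀ i j → V i j < X
    V<X i j = subst (V i j <_) (sym X≡x*x) (block-< x (Δ i j * Δ i j) x>0)

    column : ℕ → ℕ
    column j = ∑[ i < t ] X ^ i * V i j

    column<Y : ∀ j → column j < Y
    column<Y j = subst (column j <_) (^-*-assoc 2 (2 * u) t) (digits-< X t (λ i → V i j) (λ i _ → V<X i j))

  HW-K : HW K ≡ (t * t + solutionCount m) * u
  HW-K = begin
    HW K                                                   ≡⟨ HW-digits (2 * u * t) t column (λ j _ → column<Y j) ⟩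
    ∑[ j < t ] HW (column j)                               ≡⟨ ∑-cong t (λ j _ → HW-digits (2 * u) t (λ i → V i j) (λ i _ → V<X i j)) ⟩
    ∑² t (λ i j → HW (V i j))                              ≡⟨ ∑²-cong t (λ i j i<t j<t → HW-V i<t j<t) ⟩
    ∑² t (λ i j → u * (1 + 𝟙 (i * i ≟ m * j + 1)))         ≡⟨ *-distribˡ-∑² t u (λ i j → 1 + 𝟙 (i * i ≟ m * j + 1)) ⟨
    u * ∑² t (λ i j → 1 + 𝟙 (i * i ≟ m * j + 1))           ≡⟨ cong (u *_) (∑²[1+f]≡n*n+∑²f t (λ i j → 𝟙 (i * i ≟ m * j + 1))) ⟩
    u * (t * t + ∑² t (λ i j → 𝟙 (i * i ≟ m * j + 1)))     ≡⟨ cong (λ c → u * (t * t + c)) (∑-swap t t (λ j i → 𝟙 (i * i ≟ m * j + 1))) ⟩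
    u * (t * t + solutionCount m)                          ≡⟨ *-comm u _ ⟩
    (t * t + solutionCount m) * u                          ∎
    where open ≡-Reasoning

  private
    x≡1+w : x ≡ suc w
    x≡1+w = sym (trans (+-comm 1 w) (m∸n+n≡m x>0))

    X≡1+w[1+x] : X ≡ suc (w * (1 + x))
    X≡1+w[1+x] = begin
      X                        ≡⟨ X≡x*x ⟩
      x * x                    ≡⟨ cong (λ y → y * y) x≡1+w ⟩
      suc w * suc w            ≡⟨ square w ⟩
      suc (w * (1 + suc w))    ≡⟨ cong (λ y → suc (w * (1 + y))) x≡1+w ⟨
      suc (w * (1 + x))        ∎
      where
      open ≡-Reasoning
      square : ∀ w → suc w * suc w ≡ suc (w * (1 + suc w))
      square = solve-∀

    S₁ S₂ : ℕ
    S₁ = ∑[ i < t ] X ^ i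
    S₂ = ∑[ j < t ] Y ^ j

    Y≡1+w[1+x]S₁ : Y ≡ suc (w * (1 + x) * S₁)
    Y≡1+w[1+x]S₁ = trans (sym (^-*-assoc 2 (2 * u) t)) (geometric t X≡1+w[1+x])

    2^[2ut²]≡1+w[1+x]S₁S₂ : 2 ^ (2 * u * (t * t)) ≡ suc (w * (1 + x) * S₁ * S₂)
    2^[2ut²]≡1+w[1+x]S₁S₂ = trans (cong (2 ^_) (sym (*-assoc (2 * u) t t)))
      (trans (sym (^-*-assoc 2 (2 * u * t) t)) (geometric t Y≡1+w[1+x]S₁))

    G₀≡∑ : ∀ q → G 0 q t ≡ ∑[ i < t ] q ^ i
    G₀≡∑ q = trans (G≡∑ 0 q t) (∑-cong t (λ i _ → *-identityˡ (q ^ i)))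

    firstTerm≡ : firstTerm ≡ w * x * (G 0 X t * G 0 Y t)
    firstTerm≡ = begin
      x * (2 ^ (2 * u * (t * t)) ∸ 1) / (1 + x)  ≡⟨ cong (λ z → x * (z ∸ 1) / (1 + x)) 2^[2ut²]≡1+w[1+x]S₁S₂ ⟩
      x * (w * (1 + x) * S₁ * S₂) / (1 + x)      ≡⟨ cong (_/ (1 + x)) (rearrange x w S₁ S₂) ⟩
      w * x * (S₁ * S₂) * (1 + x) / (1 + x)      ≡⟨ m*n/n≡m (w * x * (S₁ * S₂)) (1 + x) ⟩
      w * x * (S₁ * S₂)                          ≡⟨ cong (w * x *_) (cong₂ _*_ (G₀≡∑ X) (G₀≡∑ Y)) ⟨
      w * x * (G 0 X t * G 0 Y t)                ∎
      where
      open ≡-Reasoning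
      rearrange : ∀ x w S₁ S₂ → x * (w * (1 + x) * S₁ * S₂) ≡ w * x * (S₁ * S₂) * (1 + x)
      rearrange = solve-∀

    monomial : ℕ → ℕ → ℕ → ℕ → ℕ
    monomial r s i j = (i ^ r * X ^ i) * (j ^ s * Y ^ j)

    Gx*Gy≡∑² : ∀ r s → G r X t * G s Y t ≡ ∑² t (monomial r s)
    Gx*Gy≡∑² r s = trans (cong₂ _*_ (G≡∑ r X t) (G≡∑ s Y t)) (∑-*-∑ t t (λ i → i ^ r * X ^ i) (λ j → j ^ s * Y ^ j))

    c*Gx*Gy≡∑² : ∀ c r s → c * G r X t * G s Y t ≡ ∑² t (λ i j → c * monomial r s i j)
    c*Gx*Gy≡∑² c r s = trans (*-assoc c _ _) (trans (cong (c *_) (Gx*Gy≡∑² r s)) (*-distribˡ-∑² t c (monomial r s)))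

    K≡∑² : K ≡ ∑² t (λ i j → Y ^ j * (X ^ i * V i j))
    K≡∑² = ∑-cong t (λ j _ → *-distribˡ-∑ t (Y ^ j) (λ i → X ^ i * V i j))

    -- V i j = w ((x + 1) − Δ²) with Δ² = i⁴ + (mj + 1)² − 2 i² (mj + 1), stated without subtraction.
    V-balance : ∀ {i j} → i < t → j < t →
                V i j + w * (i * i * (i * i) + m * m * (j * j) + 2 * m * j) ≡ w * x + w * (2 * (i * i) + 2 * m * (i * i) * j)
    V-balance {i} {j} i<t j<t = +-cancelʳ-≡ w _ _ (begin
      V i j + w * (a * a + m * m * (j * j) + 2 * m * j) + w  ≡⟨ complete-square (V i j) w a m j ⟩
      V i j + w * (a * a + b * b)                            ≡⟨ cong (λ z → V i j + w * z) (∣m-n∣²+2mn≡m²+n² a b) ⟨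
      V i j + w * (s + 2 * (a * b))                          ≡⟨ distribute (V i j) w s (2 * (a * b)) ⟩
      V i j + w * s + w * (2 * (a * b))                      ≡⟨ cong (_+ w * (2 * (a * b))) V+ws≡w[x+1] ⟩
      w * (x + 1) + w * (2 * (a * b))                        ≡⟨ expand w x a m j ⟩
      w * x + w * (2 * a + 2 * m * a * j) + w                ∎)
      where
      open ≡-Reasoning
      a b s : ℕ
      a = i * i
      b = m * j + 1
      s = Δ i j * Δ i j
      V+ws≡w[x+1] : V i j + w * s ≡ w * (x + 1)
      V+ws≡w[x+1] = trans (sym (*-distribˡ-+ w (x + 1 ∸ s) s)) (cong (w *_) (m∸n+n≡m (≤-trans (Δ²≤x i<t j<t) (m≤m+n x 1))))
      complete-square : ∀ v w a m j → v + w * (a * a + m * m * (j * j) + 2 * m * j) + w ≡ v + w * (a * a + (m * j + 1) * (m * j + 1))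
      complete-square = solve-∀
      distribute : ∀ v w s c → v + w * (s + c) ≡ v + w * s + w * c
      distribute = solve-∀
      expand : ∀ w x a m j → w * (x + 1) + w * (2 * (a * (m * j + 1))) ≡ w * x + w * (2 * a + 2 * m * a * j) + w
      expand = solve-∀

    summand-balance : ∀ {i j} → i < t → j < t →
      w * x * monomial 0 0 i j + w * (2 * monomial 2 0 i j + 2 * m * monomial 2 1 i j)
        ≡ Y ^ j * (X ^ i * V i j) + w * (monomial 4 0 i j + m * m * monomial 0 2 i j + 2 * m * monomial 0 1 i j)
    summand-balance {i} {j} i<t j<t = trans (factor i j m w x (X ^ i) (Y ^ j))
      (trans (cong (X ^ i * Y ^ j *_) (sym (V-balance i<t j<t))) (unfactor i j m w (V i j) (X ^ i) (Y ^ j)))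
      where
      factor : ∀ i j m w x P Q →
        w * x * ((1 * P) * (1 * Q)) + w * (2 * ((i * (i * 1) * P) * (1 * Q)) + 2 * m * ((i * (i * 1) * P) * (j * 1 * Q)))
          ≡ P * Q * (w * x + w * (2 * (i * i) + 2 * m * (i * i) * j))
      factor = solve-∀
      unfactor : ∀ i j m w v P Q →
        P * Q * (v + w * (i * i * (i * i) + m * m * (j * j) + 2 * m * j))
          ≡ Q * (P * v) + w * ((i * (i * (i * (i * 1))) * P) * (1 * Q) + m * m * ((1 * P) * (j * (j * 1) * Q))
                                + 2 * m * ((1 * P) * (j * 1 * Q)))
      unfactor = solve-∀

    balance : firstTerm + w * (2 * G 2 X t * G 0 Y t + 2 * m * G 2 X t * G 1 Y t)
              ≡ K + w * (G 4 X t * G 0 Y t + m * m * G 0 X t * G 2 Y t + 2 * m * G 0 X t * G 1 Y t)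
    balance = begin
      firstTerm + w * (2 * G 2 X t * G 0 Y t + 2 * m * G 2 X t * G 1 Y t)
        ≡⟨ cong₂ (λ a b → a + w * b) firstTerm≡∑² (cong₂ _+_ (c*Gx*Gy≡∑² 2 2 0) (c*Gx*Gy≡∑² (2 * m) 2 1)) ⟩
      ∑² t f₀ + w * (∑² t f₂ + ∑² t f₃)
        ≡⟨ ∑²-linear t w f₀ f₂ f₃ ⟩
      ∑² t (λ i j → f₀ i j + w * (f₂ i j + f₃ i j))
        ≡⟨ ∑²-cong t (λ i j i<t j<t → summand-balance i<t j<t) ⟩
      ∑² t (λ i j → k i j + w * (f₁ i j + f₄ i j + f₅ i j))
        ≡⟨ ∑²-linear t w k (λ i j → f₁ i j + f₄ i j) f₅ ⟨
      ∑² t k + w * (∑² t (λ i j → f₁ i j + f₄ i j) + ∑² t f₅)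
        ≡⟨ cong (λ z → ∑² t k + w * (z + ∑² t f₅)) (∑²-+ t f₁ f₄) ⟨
      ∑² t k + w * (∑² t f₁ + ∑² t f₄ + ∑² t f₅)
        ≡⟨ cong₂ (λ a b → a + w * b) K≡∑² (cong₂ _+_ (cong₂ _+_ (Gx*Gy≡∑² 4 0) (c*Gx*Gy≡∑² (m * m) 0 2)) (c*Gx*Gy≡∑² (2 * m) 0 1)) ⟨
      K + w * (G 4 X t * G 0 Y t + m * m * G 0 X t * G 2 Y t + 2 * m * G 0 X t * G 1 Y t)
        ∎
      where
      open ≡-Reasoning
      f₀ f₁ f₂ f₃ f₄ f₅ k : ℕ → ℕ → ℕ
      f₀ i j = w * x * monomial 0 0 i j
      f₁ = monomial 4 0
      f₂ i j = 2 * monomial 2 0 i j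
      f₃ i j = 2 * m * monomial 2 1 i j
      f₄ i j = m * m * monomial 0 2 i j
      f₅ i j = 2 * m * monomial 0 1 i j
      k i j = Y ^ j * (X ^ i * V i j)
      firstTerm≡∑² : firstTerm ≡ ∑² t f₀
      firstTerm≡∑² = trans firstTerm≡ (trans (cong (w * x *_) (Gx*Gy≡∑² 0 0)) (*-distribˡ-∑² t (w * x) (monomial 0 0)))

  open ℤ using (+_)

  M≡+K : M m ≡ + K
  M≡+K = trans (cong (λ b → + firstTerm ℤ.- + w ℤ.* b) bracket≡)
               (+a-+w*[q₁-q₂-q₃+q₄+q₅]≡+k firstTerm K w (G 4 X t * G 0 Y t) (2 * G 2 X t * G 0 Y t)
                 (2 * m * G 2 X t * G 1 Y t) (m * m * G 0 X t * G 2 Y t) (2 * m * G 0 X t * G 1 Y t) balance)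
    where
    g : ℕ → ℕ → ℤ.ℤ
    g r q = + G r q t
    fold₂ : ∀ a b → + a ℤ.* + b ≡ + (a * b)
    fold₂ a b = sym (ℤₚ.pos-* a b)
    fold₃ : ∀ c a b → + c ℤ.* + a ℤ.* + b ≡ + (c * a * b)
    fold₃ c a b = trans (cong (λ z → z ℤ.* + b) (fold₂ c a)) (fold₂ (c * a) b)
    bracket≡ : g 4 X ℤ.* g 0 Y ℤ.- + 2 ℤ.* g 2 X ℤ.* g 0 Y ℤ.- + (2 * m) ℤ.* g 2 X ℤ.* g 1 Y
               ℤ.+ + (m * m) ℤ.* g 0 X ℤ.* g 2 Y ℤ.+ + (2 * m) ℤ.* g 0 X ℤ.* g 1 Y
             ≡ + (G 4 X t * G 0 Y t) ℤ.- + (2 * G 2 X t * G 0 Y t) ℤ.- + (2 * m * G 2 X t * G 1 Y t)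
               ℤ.+ + (m * m * G 0 X t * G 2 Y t) ℤ.+ + (2 * m * G 0 X t * G 1 Y t)
    bracket≡ = cong₂ ℤ._+_ (cong₂ ℤ._+_ (cong₂ ℤ._-_ (cong₂ ℤ._-_ (fold₂ (G 4 X t) (G 0 Y t)) (fold₃ 2 (G 2 X t) (G 0 Y t)))
                                                 (fold₃ (2 * m) (G 2 X t) (G 1 Y t)))
                                      (fold₃ (m * m) (G 0 X t) (G 2 Y t)))
                           (fold₃ (2 * m) (G 0 X t) (G 1 Y t))

-- Roots of y (y + 1) modulo N

prime∤⇒coprime : ∀ {p b} → Prime p → p ∤ b → Coprime p b
prime∤⇒coprime pp p∤b (d∣p , d∣b) with prime⇒irreducible pp d∣p
... | inj₁ d≡1 = d≡1
... | inj₂ refl = contradiction d∣b p∤b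

prime∤1 : ∀ {p} → Prime p → p ∤ 1
prime∤1 pp p∣1 = ¬prime[1] (subst Prime (∣1⇒≡1 p∣1) pp)

linear-congruence-solvable : ∀ {p b} c → Prime p → p ∤ b → ∃[ k ] p ∣ c + k * b
linear-congruence-solvable {suc p-1} {b} c pp p∤b with coprime-Bézout (prime∤⇒coprime pp p∤b)
... | Bézout.+- x y 1+yb≡xp = y * c , divides (c * x) (begin
  c + y * c * b        ≡⟨ distrib c y b ⟩
  c * (1 + y * b)      ≡⟨ cong (c *_) 1+yb≡xp ⟩
  c * (x * suc p-1)    ≡⟨ *-assoc c x (suc p-1) ⟨
  c * x * suc p-1      ∎)
  where
  open ≡-Reasoning
  distrib : ∀ c y b → c + y * c * b ≡ c * (1 + y * b)
  distrib = solve-∀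
... | Bézout.-+ x y 1+xp≡yb = p-1 * c * y , divides (c + p-1 * c * x) (begin
  c + p-1 * c * y * b           ≡⟨ cong (c +_) (*-assoc (p-1 * c) y b) ⟩
  c + p-1 * c * (y * b)         ≡⟨ cong (λ z → c + p-1 * c * z) 1+xp≡yb ⟨
  c + p-1 * c * (1 + x * suc p-1)  ≡⟨ expand c p-1 x ⟩
  (c + p-1 * c * x) * suc p-1   ∎)
  where
  open ≡-Reasoning
  expand : ∀ c p-1 x → c + p-1 * c * (1 + x * suc p-1) ≡ (c + p-1 * c * x) * suc p-1
  expand = solve-∀

linear-congruence-unique : ∀ {p b c k l} → Prime p → p ∤ b → k < l → l < p → p ∣ c + k * b → p ∤ c + l * b
linear-congruence-unique {p} {b} {c} {k} pp p∤b k<l l<p p∣c+kb p∣c+lb with m≤n⇒∃[o]m+o≡n k<l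
... | d , refl = [ p∤1+d , p∤b ]′ (euclidsLemma (suc d) b pp p∣[1+d]b)
  where
  p∣[1+d]b : p ∣ suc d * b
  p∣[1+d]b = ∣m+n∣m⇒∣n (subst (p ∣_) (shift c k d b) p∣c+lb) p∣c+kb
    where
    shift : ∀ c k d b → c + (suc k + d) * b ≡ c + k * b + suc d * b
    shift = solve-∀
  p∤1+d : p ∤ suc d
  p∤1+d p∣1+d = <⇒≱ l<p (≤-trans (∣⇒≤ p∣1+d) (s≤s (m≤n+m d k)))

count-linear-congruence : ∀ {p b} c → Prime p → p ∤ b → ∑[ k < p ] 𝟙 (p ∣? c + k * b) ≡ 1
count-linear-congruence {p} {b} c pp p∤b with linear-congruence-solvable c pp p∤b
... | k , p∣c+kb = count-unique p (λ i → p ∣? c + i * b) (m%n<n k p) p∣c+[k%p]b unique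
  where
  instance
    p≢0 : NonZero p
    p≢0 = prime⇒nonZero pp
  p∣c+[k%p]b : p ∣ c + k % p * b
  p∣c+[k%p]b = ∣m+n∣m⇒∣n (subst (p ∣_) split p∣c+kb) (n∣m*n (k / p * b))
    where
    split : c + k * b ≡ k / p * b * p + (c + k % p * b)
    split = trans (cong (λ z → c + z * b) (m≡m%n+[m/n]*n k p)) (regroup c (k % p) (k / p) b p)
      where
      regroup : ∀ c r q b p → c + (r + q * p) * b ≡ q * b * p + (c + r * b)
      regroup = solve-∀
  unique : ∀ i → i < p → p ∣ c + i * b → i ≡ k % p
  unique i i<p p∣c+ib with <-cmp i (k % p)
  ... | tri< i<k _ _ = contradiction p∣c+[k%p]b (linear-congruence-unique pp p∤b i<k (m%n<n k p) p∣c+ib)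
  ... | tri≈ _ i≡k _ = i≡k
  ... | tri> _ _ i>k = contradiction p∣c+ib (linear-congruence-unique pp p∤b i>k i<p p∣c+[k%p]b)

prime∤consecutive : ∀ {p a} → Prime p → p ∣ a → p ∤ suc a
prime∤consecutive {p} {a} pp p∣a p∣1+a = prime∤1 pp (∣m+n∣m⇒∣n (subst (p ∣_) (+-comm 1 a) p∣1+a) p∣a)

coprime-∣⇒*∣ : ∀ {p N x} → Coprime p N → p ∣ x → N ∣ x → p * N ∣ x
coprime-∣⇒*∣ {p} {N} cop p∣x (divides q refl) =
  *-monoˡ-∣ N (coprime-divisor cop (subst (p ∣_) (*-comm q N) p∣x))

pronic : ℕ → ℕ
pronic y = y * suc y

pronicRoots : ℕ → ℕ
pronicRoots N = ∑[ y < N ] 𝟙 (N ∣? pronic y)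

pronic-shift : ∀ k N z → pronic (k * N + z) ≡ pronic z + (k * (2 * z + 1) + k * k * N) * N
pronic-shift = expand
  where
  expand : ∀ k N z → (k * N + z) * suc (k * N + z) ≡ z * suc z + (k * (2 * z + 1) + k * k * N) * N
  expand = solve-∀

∣pronic-shift⇒∣pronic : ∀ {N} k z → N ∣ pronic (k * N + z) → N ∣ pronic z
∣pronic-shift⇒∣pronic {N} k z N∣ =
  ∣m+n∣m⇒∣n (subst (N ∣_) (trans (pronic-shift k N z) (+-comm (pronic z) _)) N∣) (n∣m*n (k * (2 * z + 1) + k * k * N))

∣pronic⇒∣pronic-shift : ∀ {N} k z → N ∣ pronic z → N ∣ pronic (k * N + z)
∣pronic⇒∣pronic-shift {N} k z N∣ = subst (N ∣_) (sym (pronic-shift k N z)) (∣m∣n⇒∣m+n N∣ (n∣m*n (k * (2 * z + 1) + k * k * N)))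

liftCount : ℕ → ℕ → ℕ → ℕ
liftCount p N z = ∑[ k < p ] 𝟙 (p * N ∣? pronic (k * N + z))

pronicRoots-* : ∀ p N c → (∀ z → N ∣ pronic z → liftCount p N z ≡ c) → pronicRoots (p * N) ≡ c * pronicRoots N
pronicRoots-* p N c lifts = begin
  pronicRoots (p * N)                           ≡⟨ ∑-blocks p N (λ y → 𝟙 (p * N ∣? pronic y)) ⟩
  ∑[ k < p ] ∑[ z < N ] 𝟙 (p * N ∣? pronic (k * N + z)) ≡⟨ ∑-swap p N (λ k z → 𝟙 (p * N ∣? pronic (k * N + z))) ⟩
  ∑[ z < N ] liftCount p N z                    ≡⟨ ∑-cong N (λ z _ → liftCount≡ z) ⟩
  ∑[ z < N ] c * 𝟙 (N ∣? pronic z)              ≡⟨ *-distribˡ-∑ N c (λ z → 𝟙 (N ∣? pronic z)) ⟨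
  c * pronicRoots N                             ∎
  where
  open ≡-Reasoning
  liftCount≡ : ∀ z → liftCount p N z ≡ c * 𝟙 (N ∣? pronic z)
  liftCount≡ z with N ∣? pronic z
  ... | yes N∣ = trans (lifts z N∣) (sym (*-identityʳ c))
  ... | no  N∤ = trans (count-none p (λ k → p * N ∣? pronic (k * N + z))
                         (λ k _ pN∣ → N∤ (∣pronic-shift⇒∣pronic k z (∣-trans (n∣m*n p) pN∣))))
                       (sym (*-zeroʳ c))

-- With z (z + 1) = cN, (kN + z)(kN + z + 1) = N (c + k (2z + 1) + k² N), so the lifts of z are the
-- solutions k of a linear congruence modulo p; p ∤ 2z + 1 since p divides z or z + 1.
liftCount-∣ : ∀ {p N z} .{{_ : NonZero N}} → Prime p → p ∣ N → N ∣ pronic z → liftCount p N z ≡ 1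
liftCount-∣ {p} {N} {z} pp p∣N (divides c pronic[z]≡cN) =
  trans (∑-cong p (λ k _ → 𝟙-cong (p * N ∣? pronic (k * N + z)) (p ∣? c + k * (2 * z + 1)) (to k) (from k)))
        (count-linear-congruence c pp p∤2z+1)
  where
  pronic-shift≡ : ∀ k → pronic (k * N + z) ≡ (c + k * (2 * z + 1) + k * k * N) * N
  pronic-shift≡ k = trans (pronic-shift k N z) (trans (cong (_+ (k * (2 * z + 1) + k * k * N) * N) pronic[z]≡cN) (factor c k z N))
    where
    factor : ∀ c k z N → c * N + (k * (2 * z + 1) + k * k * N) * N ≡ (c + k * (2 * z + 1) + k * k * N) * N
    factor = solve-∀
  p∣kkN : ∀ k → p ∣ k * k * N
  p∣kkN k = ∣n⇒∣m*n (k * k) p∣N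
  to : ∀ k → p * N ∣ pronic (k * N + z) → p ∣ c + k * (2 * z + 1)
  to k pN∣ = ∣m+n∣m⇒∣n (subst (p ∣_) (+-comm _ (k * k * N)) (*-cancelʳ-∣ N (subst (p * N ∣_) (pronic-shift≡ k) pN∣))) (p∣kkN k)
  from : ∀ k → p ∣ c + k * (2 * z + 1) → p * N ∣ pronic (k * N + z)
  from k p∣ = subst (p * N ∣_) (sym (pronic-shift≡ k)) (*-monoˡ-∣ N (∣m∣n⇒∣m+n p∣ (p∣kkN k)))
  2z+1≡z+[1+z] : ∀ z → 2 * z + 1 ≡ z + suc z
  2z+1≡z+[1+z] = solve-∀
  p∤2z+1 : p ∤ 2 * z + 1
  p∤2z+1 p∣2z+1 with euclidsLemma z (suc z) pp (∣-trans p∣N (divides c pronic[z]≡cN))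
  ... | inj₁ p∣z   = prime∤consecutive pp p∣z (∣m+n∣m⇒∣n (subst (p ∣_) (2z+1≡z+[1+z] z) p∣2z+1) p∣z)
  ... | inj₂ p∣1+z = prime∤consecutive pp (∣m+n∣m⇒∣n (subst (p ∣_) (trans (2z+1≡z+[1+z] z) (+-comm z (suc z))) p∣2z+1) p∣1+z) p∣1+z

-- Here pN divides (kN + z)(kN + z + 1) iff p divides one of the two factors, and each factor is
-- divisible by p for exactly one k < p.
liftCount-∤ : ∀ {p N z} → Prime p → p ∤ N → N ∣ pronic z → liftCount p N z ≡ 2
liftCount-∤ {p} {N} {z} pp p∤N N∣pronic[z] =
  trans (∑-cong p (λ k _ → 𝟙-⊎ (p ∣? z + k * N) (p ∣? suc z + k * N) (p * N ∣? pronic (k * N + z))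
                                (to k) (from₁ k) (from₂ k) (prime∤consecutive pp)))
        (trans (∑-distrib-+ p (λ k → 𝟙 (p ∣? z + k * N)) (λ k → 𝟙 (p ∣? suc z + k * N)))
               (cong₂ _+_ (count-linear-congruence z pp p∤N) (count-linear-congruence (suc z) pp p∤N)))
  where
  lift : ∀ k → p ∣ pronic (k * N + z) → p * N ∣ pronic (k * N + z)
  lift k p∣ = coprime-∣⇒*∣ (prime∤⇒coprime pp p∤N) p∣ (∣pronic⇒∣pronic-shift k z N∣pronic[z])
  to : ∀ k → p * N ∣ pronic (k * N + z) → p ∣ z + k * N ⊎ p ∣ suc z + k * N
  to k pN∣ with euclidsLemma (k * N + z) (suc (k * N + z)) pp (∣-trans (m∣m*n N) pN∣)
  ... | inj₁ p∣y   = inj₁ (subst (p ∣_) (+-comm (k * N) z) p∣y)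
  ... | inj₂ p∣1+y = inj₂ (subst (p ∣_) (cong suc (+-comm (k * N) z)) p∣1+y)
  from₁ : ∀ k → p ∣ z + k * N → p * N ∣ pronic (k * N + z)
  from₁ k p∣ = lift k (∣m⇒∣m*n (suc (k * N + z)) (subst (p ∣_) (+-comm z (k * N)) p∣))
  from₂ : ∀ k → p ∣ suc z + k * N → p * N ∣ pronic (k * N + z)
  from₂ k p∣ = lift k (∣n⇒∣m*n (k * N + z) (subst (p ∣_) (cong suc (+-comm z (k * N))) p∣))

pronicRoots-*-∣ : ∀ {p N} .{{_ : NonZero N}} → Prime p → p ∣ N → pronicRoots (p * N) ≡ pronicRoots N
pronicRoots-*-∣ {p} {N} pp p∣N = trans (pronicRoots-* p N 1 (λ _ → liftCount-∣ pp p∣N)) (*-identityˡ (pronicRoots N))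

pronicRoots-*-∤ : ∀ {p N} → Prime p → p ∤ N → pronicRoots (p * N) ≡ 2 * pronicRoots N
pronicRoots-*-∤ {p} {N} pp p∤N = pronicRoots-* p N 2 (λ _ → liftCount-∤ pp p∤N)

pronicRoots-*-product : ∀ {N} .{{_ : NonZero N}} fs → All Prime fs → All (_∣ N) fs →
                        pronicRoots (product fs * N) ≡ pronicRoots N
pronicRoots-*-product {N} []       []          []          = cong pronicRoots (+-identityʳ N)
pronicRoots-*-product {N} (q ∷ fs) (pq ∷ pfs) (q∣N ∷ fs∣N) = begin
  pronicRoots (q * product fs * N)    ≡⟨ cong pronicRoots (*-assoc q (product fs) N) ⟩
  pronicRoots (q * (product fs * N))  ≡⟨ pronicRoots-*-∣ {{m*n≢0 (product fs) N {{productOfPrimes≢0 pfs}}}} pq (∣n⇒∣m*n (product fs) q∣N) ⟩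
  pronicRoots (product fs * N)        ≡⟨ pronicRoots-*-product fs pfs fs∣N ⟩
  pronicRoots N                       ∎
  where open ≡-Reasoning

prime∣n!⇒≤n : ∀ {p} n → Prime p → p ∣ n ! → p ≤ n
prime∣n!⇒≤n zero    pp p∣1 = contradiction p∣1 (prime∤1 pp)
prime∣n!⇒≤n (suc n) pp p∣n! with euclidsLemma (suc n) (n !) pp p∣n!
... | inj₁ p∣1+n = ∣⇒≤ p∣1+n
... | inj₂ p∣n!  = m≤n⇒m≤1+n (prime∣n!⇒≤n n pp p∣n!)

≤n⇒∣n! : ∀ {q} n → .{{_ : NonZero q}} → q ≤ n → q ∣ n !
≤n⇒∣n! {suc q} n q≤n = ∣-trans (m∣m*n (q !)) (m≤n⇒m!∣n! q≤n)

length-filter-applyUpTo : ∀ {P : Pred ℕ 0ℓ} (P? : Decidable P) n f →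
                          length (filter P? (applyUpTo f n)) ≡ ∑[ i < n ] 𝟙 (P? (f i))
length-filter-applyUpTo P? zero    f = refl
length-filter-applyUpTo P? (suc n) f with P? (f 0)
... | yes _ = cong suc (length-filter-applyUpTo P? n (f ∘ suc))
... | no  _ = length-filter-applyUpTo P? n (f ∘ suc)

primeCount-suc : ∀ n → primeCount (suc n) ≡ primeCount n + 𝟙 (prime? (suc n))
primeCount-suc n = begin
  primeCount (suc n)                                ≡⟨ length-filter-applyUpTo prime? (2 + n) (λ i → i) ⟩
  ∑[ i < 2 + n ] 𝟙 (prime? i)                       ≡⟨ cong (λ k → ∑[ i < k ] 𝟙 (prime? i)) (+-comm 1 (suc n)) ⟩
  ∑[ i < suc n + 1 ] 𝟙 (prime? i)                   ≡⟨ ∑-split (suc n) 1 (λ i → 𝟙 (prime? i)) ⟩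
  (∑[ i < suc n ] 𝟙 (prime? i)) + (𝟙 (prime? (suc n + 0)) + 0)
     ≡⟨ cong₂ _+_ (sym (length-filter-applyUpTo prime? (suc n) (λ i → i)))
                  (trans (+-identityʳ _) (cong (λ k → 𝟙 (prime? k)) (+-identityʳ (suc n)))) ⟩
  primeCount n + 𝟙 (prime? (suc n))                 ∎
  where open ≡-Reasoning

2*2^k≡2^[k+1] : ∀ k → 2 * 2 ^ k ≡ 2 ^ (k + 1)
2*2^k≡2^[k+1] k = trans (*-comm 2 (2 ^ k)) (sym (^-distribˡ-+-* 2 k 1))

pronicRoots[n!]≡2^π[n] : ∀ n → pronicRoots (n !) ≡ 2 ^ primeCount n
pronicRoots[n!]≡2^π[n] zero    = refl
pronicRoots[n!]≡2^π[n] (suc n) = trans (step (prime? (suc n))) (cong (2 ^_) (sym (primeCount-suc n)))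
  where
  instance
    n!≢0 : NonZero (n !)
    n!≢0 = n !≢0
  step : (p? : Dec (Prime (suc n))) → pronicRoots (suc n * n !) ≡ 2 ^ (primeCount n + 𝟙 p?)
  step (yes 1+n-prime) = begin
    pronicRoots (suc n * n !)   ≡⟨ pronicRoots-*-∤ 1+n-prime (λ 1+n∣n! → <-irrefl refl (prime∣n!⇒≤n n 1+n-prime 1+n∣n!)) ⟩
    2 * pronicRoots (n !)       ≡⟨ cong (2 *_) (pronicRoots[n!]≡2^π[n] n) ⟩
    2 * 2 ^ primeCount n        ≡⟨ 2*2^k≡2^[k+1] (primeCount n) ⟩
    2 ^ (primeCount n + 1)      ∎
    where open ≡-Reasoning
  step (no ¬1+n-prime) = begin
    pronicRoots (suc n * n !)                ≡⟨ cong (λ k → pronicRoots (k * n !)) (isFactorisation F) ⟩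
    pronicRoots (product (factors F) * n !)  ≡⟨ pronicRoots-*-product (factors F) (factorsPrime F) (All.tabulate factor∣n!) ⟩
    pronicRoots (n !)                        ≡⟨ pronicRoots[n!]≡2^π[n] n ⟩
    2 ^ primeCount n                         ≡⟨ cong (2 ^_) (+-identityʳ (primeCount n)) ⟨
    2 ^ (primeCount n + 0)                   ∎
    where
    open ≡-Reasoning
    F : PrimeFactorisation (suc n)
    F = factorise (suc n)
    factor∣n! : ∀ {q} → q ∈ factors F → q ∣ n !
    factor∣n! {q} q∈F = ≤n⇒∣n! n {{prime⇒nonZero q-prime}} (≤-pred (≤∧≢⇒< q≤1+n q≢1+n))
      where
      q-prime : Prime q
      q-prime = All.lookup (factorsPrime F) q∈F
      q≤1+n : q ≤ suc n
      q≤1+n = ∣⇒≤ (subst (q ∣_) (sym (isFactorisation F)) (∈⇒∣product q∈F))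
      q≢1+n : q ≢ suc n
      q≢1+n refl = ¬1+n-prime q-prime

∑-pronic-periodic : ∀ k N → ∑[ y < k * N ] 𝟙 (N ∣? pronic y) ≡ k * pronicRoots N
∑-pronic-periodic k N = begin
  ∑[ y < k * N ] 𝟙 (N ∣? pronic y)                     ≡⟨ ∑-blocks k N (λ y → 𝟙 (N ∣? pronic y)) ⟩
  ∑[ q < k ] ∑[ z < N ] 𝟙 (N ∣? pronic (q * N + z))    ≡⟨ ∑-cong k (λ q _ → ∑-cong N (λ z _ →
                                                            𝟙-cong _ _ (∣pronic-shift⇒∣pronic q z) (∣pronic⇒∣pronic-shift q z))) ⟩
  ∑[ q < k ] pronicRoots N                             ≡⟨ ∑-const k (pronicRoots N) ⟩
  k * pronicRoots N                                    ∎
  where open ≡-Reasoning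

pronic≡qN⇒q<4N : ∀ {N y q} .{{_ : NonZero N}} → y < 2 * N → pronic y ≡ q * N → q < 4 * N
pronic≡qN⇒q<4N {N} {y} {q} y<2N pronic[y]≡qN = *-cancelʳ-< N q (4 * N) (begin-strict
  q * N            ≡⟨ pronic[y]≡qN ⟨
  y * suc y        ≤⟨ *-monoʳ-≤ y y<2N ⟩
  y * (2 * N)      <⟨ *-monoˡ-< (2 * N) {{m*n≢0 2 N}} y<2N ⟩
  2 * N * (2 * N)  ≡⟨ square N ⟩
  4 * N * N        ∎)
  where
  open ≤-Reasoning
  square : ∀ N → 2 * N * (2 * N) ≡ 4 * N * N
  square = solve-∀

odd-square : ∀ y → suc (y * 2) * suc (y * 2) ≡ 4 * pronic y + 1
odd-square = expand
  where
  expand : ∀ y → suc (y * 2) * suc (y * 2) ≡ 4 * (y * suc y) + 1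
  expand = solve-∀

odd-square≡4Nj+1⇒pronic≡Nj : ∀ N y j → suc (y * 2) * suc (y * 2) ≡ 4 * N * j + 1 → pronic y ≡ N * j
odd-square≡4Nj+1⇒pronic≡Nj N y j eq =
  *-cancelˡ-≡ (pronic y) (N * j) 4 (+-cancelʳ-≡ 1 _ _ (trans (sym (odd-square y)) (trans eq (cong (_+ 1) (*-assoc 4 N j)))))

pronic≡Nj⇒odd-square≡4Nj+1 : ∀ N y j → pronic y ≡ N * j → suc (y * 2) * suc (y * 2) ≡ 4 * N * j + 1
pronic≡Nj⇒odd-square≡4Nj+1 N y j eq = trans (odd-square y) (trans (cong (λ z → 4 * z + 1) eq) (cong (_+ 1) (sym (*-assoc 4 N j))))

solutionsAt-zero : ∀ m → solutionsAt m 0 ≡ 0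
solutionsAt-zero m = count-none (suc m) (λ j → 0 ≟ m * j + 1) (λ j _ 0≡mj+1 → 0≢1+n (trans 0≡mj+1 (+-comm (m * j) 1)))

solutionsAt-even : ∀ N y → solutionsAt (4 * N) (suc (y * 2 + 1)) ≡ 0
solutionsAt-even N y = count-none (suc (4 * N)) (λ j → suc (y * 2 + 1) * suc (y * 2 + 1) ≟ 4 * N * j + 1)
  (λ j _ eq → even≢odd (2 * (suc y * suc y)) (2 * N * j) (trans (sym (even-square y)) (trans eq (odd-form N j))))
  where
  even-square : ∀ y → suc (y * 2 + 1) * suc (y * 2 + 1) ≡ 2 * (2 * (suc y * suc y))
  even-square = solve-∀
  odd-form : ∀ N j → 4 * N * j + 1 ≡ suc (2 * (2 * N * j))
  odd-form = solve-∀

solutionsAt-odd : ∀ N .{{_ : NonZero N}} {y} → y < 2 * N → solutionsAt (4 * N) (suc (y * 2)) ≡ 𝟙 (N ∣? pronic y)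
solutionsAt-odd N {y} y<2N with N ∣? pronic y
... | no N∤pronic[y] = count-none (suc (4 * N)) (λ j → suc (y * 2) * suc (y * 2) ≟ 4 * N * j + 1)
        (λ j _ eq → N∤pronic[y] (divides j (trans (odd-square≡4Nj+1⇒pronic≡Nj N y j eq) (*-comm N j))))
... | yes (divides c pronic[y]≡cN) =
  count-unique (suc (4 * N)) (λ j → suc (y * 2) * suc (y * 2) ≟ 4 * N * j + 1)
    (m<n⇒m<1+n (pronic≡qN⇒q<4N y<2N pronic[y]≡cN))
    (pronic≡Nj⇒odd-square≡4Nj+1 N y c (trans pronic[y]≡cN (*-comm c N)))
    (λ j _ eq → *-cancelʳ-≡ j c N (trans (*-comm j N) (trans (sym (odd-square≡4Nj+1⇒pronic≡Nj N y j eq)) pronic[y]≡cN)))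

solutionCount[4N]≡2*pronicRoots[N] : ∀ N .{{_ : NonZero N}} → solutionCount (4 * N) ≡ 2 * pronicRoots N
solutionCount[4N]≡2*pronicRoots[N] N = begin
  S 0 + (∑[ i < 4 * N ] S (suc i))                      ≡⟨ cong₂ _+_ (solutionsAt-zero (4 * N)) (cong (λ k → ∑[ i < k ] S (suc i)) (4N≡2N*2 N)) ⟩
  ∑[ i < 2 * N * 2 ] S (suc i)                          ≡⟨ ∑-blocks (2 * N) 2 (S ∘ suc) ⟩
  ∑[ y < 2 * N ] (S (suc (y * 2 + 0)) + (S (suc (y * 2 + 1)) + 0))
                                                        ≡⟨ ∑-cong (2 * N) (λ y y<2N → cong₂ (λ a b → a + (b + 0))
                                                             (trans (cong (S ∘ suc) (+-identityʳ (y * 2))) (solutionsAt-odd N y<2N))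
                                                             (solutionsAt-even N y)) ⟩
  ∑[ y < 2 * N ] (𝟙 (N ∣? pronic y) + (0 + 0))         ≡⟨ ∑-cong (2 * N) (λ y _ → +-identityʳ _) ⟩
  ∑[ y < 2 * N ] 𝟙 (N ∣? pronic y)                     ≡⟨ ∑-pronic-periodic 2 N ⟩
  2 * pronicRoots N                                    ∎
  where
  open ≡-Reasoning
  S : ℕ → ℕ
  S = solutionsAt (4 * N)
  4N≡2N*2 : ∀ N → 4 * N ≡ 2 * N * 2
  4N≡2N*2 = solve-∀

solutionCount[4n!]≡2^[π[n]+1] : ∀ n → solutionCount (4 * n !) ≡ 2 ^ (primeCount n + 1)
solutionCount[4n!]≡2^[π[n]+1] n = begin
  solutionCount (4 * n !)       ≡⟨ solutionCount[4N]≡2*pronicRoots[N] (n !) {{n !≢0}} ⟩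
  2 * pronicRoots (n !)         ≡⟨ cong (2 *_) (pronicRoots[n!]≡2^π[n] n) ⟩
  2 * 2 ^ primeCount n          ≡⟨ 2*2^k≡2^[k+1] (primeCount n) ⟩
  2 ^ (primeCount n + 1)        ∎
  where open ≡-Reasoning

IsNu2[2^k]k : ∀ k → IsNu2 (2 ^ k) k
IsNu2[2^k]k k = ∣-refl , λ 2^[1+k]∣2^k → <⇒≱ (^-monoʳ-< 2 (s<s z<s) (n<1+n k)) (∣⇒≤ {{m^n≢0 2 k}} 2^[1+k]∣2^k)

quotient-readout : ∀ {h} s k d .{{_ : NonZero d}} → h ≡ (s + 2 ^ k) * d →
                   d ∣ h × s < h / d × IsNu2 (h / d ∸ s) k
quotient-readout s k d refl =
  divides (s + 2 ^ k) refl ,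
  subst (s <_) (sym quotient≡) (m<m+n s (m^n>0 2 k)) ,
  subst (λ e → IsNu2 (e ∸ s) k) (sym quotient≡) (subst (λ e → IsNu2 e k) (sym (m+n∸m≡n s (2 ^ k))) (IsNu2[2^k]k k))
  where
  quotient≡ : (s + 2 ^ k) * d / d ≡ s + 2 ^ k
  quotient≡ = m*n/n≡m (s + 2 ^ k) d

open ℤ using (+_)

mainTheorem2 : (n : ℕ) →
    Σ ℕ (λ K → (M (4 * n !) ≡ + K)
      × ((5 + 4 * n !) ∣ HW K)
      × ((4 * n ! + 1) ^ 2 < HW K / (5 + 4 * n !))
      × IsNu2 (HW K / (5 + 4 * n !) ∸ (4 * n ! + 1) ^ 2) (primeCount n + 1))
mainTheorem2 n = K , M≡+K , quotient-readout ((m + 1) ^ 2) (primeCount n + 1) (5 + m) HW[K]≡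
  where
  m : ℕ
  m = 4 * n !
  open BaseExpansion m
  HW[K]≡ : HW K ≡ ((m + 1) ^ 2 + 2 ^ (primeCount n + 1)) * (5 + m)
  HW[K]≡ = begin
    HW K                                                ≡⟨ HW-K ⟩
    (suc m * suc m + solutionCount m) * (m + 5)         ≡⟨ cong₂ (λ a b → (a + b) * (m + 5)) (square m) (solutionCount[4n!]≡2^[π[n]+1] n) ⟩
    ((m + 1) ^ 2 + 2 ^ (primeCount n + 1)) * (m + 5)    ≡⟨ cong (((m + 1) ^ 2 + 2 ^ (primeCount n + 1)) *_) (+-comm m 5) ⟩
    ((m + 1) ^ 2 + 2 ^ (primeCount n + 1)) * (5 + m)    ∎
    where
    open ≡-Reasoning
    square : ∀ m → suc m * suc m ≡ (m + 1) * ((m + 1) * 1)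
    square = solve-∀
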